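{- For all integers $a,b\geq0$, the following identity of rational functions in an indeterminate $z$ holds (the sum is finite since its terms vanish for $t>b$): $$\sum_{t=a}^{\infty}\frac{(b+t)_{2t}}{(z+t)_{2t+2}}=\frac{(b+a)_{2a}}{(z+b)\,(z+a-1)_{2a}\,(z-b-1)}.$$
   Context: For an integer $k\geq0$, $(\alpha)_k=\alpha(\alpha-1)\cdots(\alpha-k+1)$ (falling factorial), with $(\alpha)_0=1$. -}

module Defs where

open import Data.Nat as ℕ using (ℕ; zero; suc; _∸_)
open import Data.Integer as ℤ using (ℤ)
open import Data.Rational using (ℚ; 0ℚ; 1ℚ; _+_; _-_; _*_; _÷_; _≟_; ≢-nonZero)
open import Data.List using (List; map; upTo; foldr)
open import Relation.Nullary using (yes; no)

ℕ→ℚ : ℕ → ℚ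
ℕ→ℚ n = ℤ.+ n Data.Rational./ 1

ff : ℚ → ℕ → ℚ
ff α zero    = 1ℚ
ff α (suc k) = ff α k * (α - ℕ→ℚ k)

-- total division: x ⊘ y = x / y if y ≠ 0 (and 0 otherwise; only used
-- under hypotheses guaranteeing y ≠ 0)
_⊘_ : ℚ → ℚ → ℚ
x ⊘ y with y ≟ 0ℚ
... | yes _  = 0ℚ
... | no y≢0 = _÷_ x y {{≢-nonZero y≢0}}

sumℚ : List ℚ → ℚ
sumℚ = foldr _+_ 0ℚ

-- Σ_{t=a}^{N} f t
sumFromTo : ℕ → ℕ → (ℕ → ℚ) → ℚ
sumFromTo a N f = sumℚ (map (λ i → f (a ℕ.+ i)) (upTo (suc N ∸ a)))

-- The sum telescopes. Put R t = (b+t)_{2t} / ((z+b) (z+t-1)_{2t} (z-b-1)). As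
-- (z+t)_{2t+2} = (z+t) (z+t-1)_{2t} (z-t-1) = (z+t+1-1)_{2(t+1)} and
-- (b+t+1)_{2t+2} = (b+t+1) (b+t)_{2t} (b-t), the relation
-- (b+t)_{2t} / (z+t)_{2t+2} + R (t+1) = R t reduces, after clearing denominators,
-- to the quadratic identity (z+b)(z-b-1) + (b+t+1)(b-t) = (z+t)(z-t-1).
-- For t > b the numerator (b+t)_{2t} contains the factor 0, so R t = 0 and the
-- sum from a equals R a. The hypothesis on z makes every denominator with t ≤ b
-- nonzero: all their factors have the form z - k with -b ≤ k ≤ b+1.
module Submission where

open import Defs
open import Data.Nat using (ℕ; _≥_; suc)
import Data.Nat
open import Data.Integer using (ℤ; -_; +_) renaming (_≤_ to _≤ℤ_)
open import Data.Rational using (ℚ; _+_; _-_; _*_; _/_)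
open import Relation.Binary.PropositionalEquality using (_≡_; _≢_)

open import Data.Nat as ℕ using (zero; _≤_; _<_; s≤s)
import Data.Nat.Properties as ℕP
import Data.Nat.Coprimality as Coprimality
import Data.Integer as ℤ
import Data.Integer.Properties as ℤP
import Data.Rational as ℚ
open import Data.Rational using (mkℚ; 0ℚ; 1ℚ; 1/_; _≟_; ≢-nonZero)
open import Data.Rational.Properties
  using (↥p/↧p≡p; /-cong; +-identityˡ; +-identityʳ; +-assoc; +-inverseʳ; *-identityʳ;
         *-zeroˡ; *-zeroʳ; *-assoc; *-comm; *-distribʳ-+; *-inverseˡ; *-inverseʳ; +-0-group)
open import Algebra.Properties.Group +-0-group using (x∙y⁻¹≈ε⇒x≈y; ⁻¹-involutive)
open import Data.Rational.Solver using (module +-*-Solver)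
open +-*-Solver
open import Data.List using (applyUpTo)
open import Data.List.Properties using (map-upTo)
open import Data.Sum using (inj₁; inj₂)
open import Data.Empty using (⊥-elim)
open import Relation.Nullary using (yes; no)
open import Relation.Binary.PropositionalEquality
  using (refl; sym; trans; cong; cong₂; subst; module ≡-Reasoning)

/1-canonical : ∀ k → k / 1 ≡ mkℚ k 0 (Coprimality.sym (Coprimality.1-coprimeTo ℤ.∣ k ∣))
/1-canonical k = ↥p/↧p≡p (mkℚ k 0 (Coprimality.sym (Coprimality.1-coprimeTo _)))

/1-+ : ∀ k l → (k ℤ.+ l) / 1 ≡ k / 1 + l / 1
/1-+ k l rewrite /1-canonical k | /1-canonical l =
  /-cong (sym (cong₂ ℤ._+_ (ℤP.*-identityʳ k) (ℤP.*-identityʳ l))) refl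

/1-neg : ∀ k → (ℤ.- k) / 1 ≡ ℚ.- (k / 1)
/1-neg k rewrite /1-canonical k | /1-canonical (ℤ.- k) = canonical-neg k
  where
  canonical-neg : ∀ k → mkℚ (ℤ.- k) 0 (Coprimality.sym (Coprimality.1-coprimeTo _))
                      ≡ ℚ.- mkℚ k 0 (Coprimality.sym (Coprimality.1-coprimeTo _))
  canonical-neg (+ zero)   = refl
  canonical-neg (+ suc n)  = refl
  canonical-neg ℤ.-[1+ n ] = refl

ℕ→ℚ-+ : ∀ m n → ℕ→ℚ (m ℕ.+ n) ≡ ℕ→ℚ m + ℕ→ℚ n
ℕ→ℚ-+ m n = /1-+ (+ m) (+ n)

ℕ→ℚ-suc : ∀ n → ℕ→ℚ (suc n) ≡ ℕ→ℚ n + 1ℚ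
ℕ→ℚ-suc n = trans (cong ℕ→ℚ (ℕP.+-comm 1 n)) (ℕ→ℚ-+ n 1)

ℕ→ℚ-double : ∀ n → ℕ→ℚ (2 ℕ.* n) ≡ ℕ→ℚ n + ℕ→ℚ n
ℕ→ℚ-double n = trans (ℕ→ℚ-+ n (n ℕ.+ 0)) (cong (λ m → ℕ→ℚ n + ℕ→ℚ m) (ℕP.+-identityʳ n))

*-cancelʳ-≢0 : ∀ p q r → r ≢ 0ℚ → p * r ≡ q * r → p ≡ q
*-cancelʳ-≢0 p q r r≢0 pr≡qr = begin
  p              ≡⟨ sym (*-identityʳ p) ⟩
  p * 1ℚ         ≡⟨ cong (p *_) (sym (*-inverseʳ r)) ⟩
  p * (r * 1/ r) ≡⟨ sym (*-assoc p r _) ⟩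
  p * r * 1/ r   ≡⟨ cong (_* 1/ r) pr≡qr ⟩
  q * r * 1/ r   ≡⟨ *-assoc q r _ ⟩
  q * (r * 1/ r) ≡⟨ cong (q *_) (*-inverseʳ r) ⟩
  q * 1ℚ         ≡⟨ *-identityʳ q ⟩
  q              ∎
  where
  open ≡-Reasoning
  instance _ = ≢-nonZero r≢0

*-≢0 : ∀ {p q} → p ≢ 0ℚ → q ≢ 0ℚ → p * q ≢ 0ℚ
*-≢0 {p} {q} p≢0 q≢0 pq≡0 =
  q≢0 (*-cancelʳ-≢0 q 0ℚ p p≢0 (trans (*-comm q p) (trans pq≡0 (sym (*-zeroˡ p)))))

⊘-zeroˡ : ∀ y → 0ℚ ⊘ y ≡ 0ℚ
⊘-zeroˡ y with y ≟ 0ℚ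
... | yes _   = refl
... | no y≢0 = *-zeroˡ (1/ y) where instance _ = ≢-nonZero y≢0

[x⊘y]*y≡x : ∀ x y → y ≢ 0ℚ → (x ⊘ y) * y ≡ x
[x⊘y]*y≡x x y y≢0 with y ≟ 0ℚ
... | yes y≡0 = ⊥-elim (y≢0 y≡0)
... | no y≢0′ = trans (*-assoc x _ y)
                  (trans (cong (x *_) (*-inverseˡ y {{≢-nonZero y≢0′}})) (*-identityʳ x))

ff-shift : ∀ α k → ff (α + 1ℚ) (suc k) ≡ (α + 1ℚ) * ff α k
ff-shift α zero = solve 1 (λ a → con 1ℚ :* ((a :+ con 1ℚ) :- con 0ℚ) := (a :+ con 1ℚ) :* con 1ℚ) refl α
ff-shift α (suc k) rewrite ff-shift α k | ℕ→ℚ-suc k =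
  solve 3 (λ a F K → (a :+ con 1ℚ) :* F :* ((a :+ con 1ℚ) :- (K :+ con 1ℚ))
                   := (a :+ con 1ℚ) :* (F :* (a :- K))) refl α (ff α k) (ℕ→ℚ k)

ff-shift-suc : ∀ α k → ff (α + 1ℚ) (suc (suc k)) ≡ (α + 1ℚ) * ff α k * (α - ℕ→ℚ k)
ff-shift-suc α k rewrite ff-shift α k | ℕ→ℚ-suc k =
  solve 3 (λ a F K → (a :+ con 1ℚ) :* F :* ((a :+ con 1ℚ) :- (K :+ con 1ℚ))
                   := (a :+ con 1ℚ) :* F :* (a :- K)) refl α (ff α k) (ℕ→ℚ k)

ff-ℕ-vanishes : ∀ j k → j < k → ff (ℕ→ℚ j) k ≡ 0ℚ
ff-ℕ-vanishes j (suc k) (s≤s j≤k) with ℕP.m≤n⇒m<n∨m≡n j≤k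
... | inj₁ j<k  rewrite ff-ℕ-vanishes j k j<k = *-zeroˡ (ℕ→ℚ j - ℕ→ℚ k)
... | inj₂ refl rewrite +-inverseʳ (ℕ→ℚ j) = *-zeroʳ (ff (ℕ→ℚ j) j)

ff-≢0 : ∀ α k → (∀ i → i < k → α - ℕ→ℚ i ≢ 0ℚ) → ff α k ≢ 0ℚ
ff-≢0 α zero    factors≢0 = λ ()
ff-≢0 α (suc k) factors≢0 =
  *-≢0 (ff-≢0 α k (λ i i<k → factors≢0 i (ℕP.m<n⇒m<1+n i<k))) (factors≢0 k ℕP.≤-refl)

applyUpTo-telescope : ∀ (h S : ℕ → ℚ) → (∀ i → h i + S (suc i) ≡ S i) →
                      ∀ m → sumℚ (applyUpTo h m) + S m ≡ S 0
applyUpTo-telescope h S step zero    = +-identityˡ (S 0)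
applyUpTo-telescope h S step (suc m) = begin
  (h 0 + sumℚ (applyUpTo (λ i → h (suc i)) m)) + S (suc m)
    ≡⟨ +-assoc (h 0) _ (S (suc m)) ⟩
  h 0 + (sumℚ (applyUpTo (λ i → h (suc i)) m) + S (suc m))
    ≡⟨ cong (_+_ (h 0)) (applyUpTo-telescope (λ i → h (suc i)) (λ i → S (suc i)) (λ i → step (suc i)) m) ⟩
  h 0 + S 1
    ≡⟨ step 0 ⟩
  S 0 ∎
  where open ≡-Reasoning

sumFromTo-telescope : ∀ (f R : ℕ → ℚ) → (∀ t → f t + R (suc t) ≡ R t) →
                      ∀ a N → (∀ t → N < t → R t ≡ 0ℚ) → sumFromTo a N f ≡ R a
sumFromTo-telescope f R step a N R-vanishes = begin
  sumFromTo a N f           ≡⟨ cong sumℚ (map-upTo (λ i → f (a ℕ.+ i)) m) ⟩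
  S                         ≡⟨ sym (+-identityʳ S) ⟩
  S + 0ℚ                    ≡⟨ cong (_+_ S) (sym (R-vanishes (a ℕ.+ m) (ℕP.m≤n+m∸n (suc N) a))) ⟩
  S + R (a ℕ.+ m)           ≡⟨ applyUpTo-telescope (λ i → f (a ℕ.+ i)) (λ i → R (a ℕ.+ i)) shifted-step m ⟩
  R (a ℕ.+ 0)               ≡⟨ cong R (ℕP.+-identityʳ a) ⟩
  R a                       ∎
  where
  open ≡-Reasoning
  m = suc N ℕ.∸ a
  S = sumℚ (applyUpTo (λ i → f (a ℕ.+ i)) m)
  shifted-step : ∀ i → f (a ℕ.+ i) + R (a ℕ.+ suc i) ≡ R (a ℕ.+ i)
  shifted-step i = trans (cong (λ j → f (a ℕ.+ i) + R j) (ℕP.+-suc a i)) (step (a ℕ.+ i))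

quadratic-identity : ∀ z B T →
  (z + B) * (z - B - 1ℚ) + (B + T + 1ℚ) * (B - T) ≡ (z + T) * (z - (T + 1ℚ))
quadratic-identity = solve 3 (λ z B T →
  (z :+ B) :* (z :- B :- con 1ℚ) :+ (B :+ T :+ con 1ℚ) :* (B :- T)
    := (z :+ T) :* (z :- (T :+ con 1ℚ))) refl

module ClosedForm (b : ℕ) (z : ℚ)
  (z∉[-b,b+1] : ∀ (k : ℤ) → - (+ b) ≤ℤ k → k ≤ℤ + suc b → z ≢ k / 1) where

  B : ℚ
  B = ℕ→ℚ b

  numerator denominator : ℕ → ℚ
  numerator t   = ff (B + ℕ→ℚ t) (2 ℕ.* t)
  denominator t = ff (z + ℕ→ℚ t) (2 ℕ.* t ℕ.+ 2)

  term : ℕ → ℚ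
  term t = numerator t ⊘ denominator t

  inner : ℕ → ℚ
  inner t = ff (z + ℕ→ℚ t - ℕ→ℚ 1) (2 ℕ.* t)

  remainder-denominator : ℕ → ℚ
  remainder-denominator t = ((z + B) * inner t) * (z - B - ℕ→ℚ 1)

  remainder : ℕ → ℚ
  remainder t = numerator t ⊘ remainder-denominator t

  z-m≢0 : ∀ m → m ≤ suc b → z - ℕ→ℚ m ≢ 0ℚ
  z-m≢0 m m≤1+b z-m≡0 =
    z∉[-b,b+1] (+ m) ℤP.neg-≤-pos (ℤ.+≤+ m≤1+b) (x∙y⁻¹≈ε⇒x≈y z (ℕ→ℚ m) z-m≡0)

  z+m≢0 : ∀ m → m ≤ b → z + ℕ→ℚ m ≢ 0ℚ
  z+m≢0 m m≤b z+m≡0 =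
    z∉[-b,b+1] (ℤ.- + m) (ℤP.neg-mono-≤ (ℤ.+≤+ m≤b)) ℤP.neg-≤-pos (x∙y⁻¹≈ε⇒x≈y z _ z+m≡0′)
    where
    z+m≡0′ : z - (ℤ.- + m) / 1 ≡ 0ℚ
    z+m≡0′ = trans (cong (λ q → z - q) (/1-neg (+ m)))
               (trans (cong (_+_ z) (⁻¹-involutive (ℕ→ℚ m))) z+m≡0)

  z+j-i≢0 : ∀ j i → j ≤ i ℕ.+ b → i ≤ j ℕ.+ suc b → z + ℕ→ℚ j - ℕ→ℚ i ≢ 0ℚ
  z+j-i≢0 j i j≤i+b i≤j+1+b with ℕP.≤-total j i
  ... | inj₁ j≤i = subst (_≢ 0ℚ) (sym z+j-i≡z-m) (z-m≢0 m (ℕP.m≤n+o⇒m∸n≤o i j i≤j+1+b))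
    where
    m = i ℕ.∸ j
    z+j-i≡z-m : z + ℕ→ℚ j - ℕ→ℚ i ≡ z - ℕ→ℚ m
    z+j-i≡z-m = trans (cong (λ k → z + ℕ→ℚ j - k)
                        (trans (cong ℕ→ℚ (sym (ℕP.m+[n∸m]≡n j≤i))) (ℕ→ℚ-+ j m)))
                      (solve 3 (λ z J M → z :+ J :- (J :+ M) := z :- M) refl z (ℕ→ℚ j) (ℕ→ℚ m))
  ... | inj₂ i≤j = subst (_≢ 0ℚ) (sym z+j-i≡z+m) (z+m≢0 m (ℕP.m≤n+o⇒m∸n≤o j i j≤i+b))
    where
    m = j ℕ.∸ i
    z+j-i≡z+m : z + ℕ→ℚ j - ℕ→ℚ i ≡ z + ℕ→ℚ m
    z+j-i≡z+m = trans (cong (λ k → z + k - ℕ→ℚ i)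
                        (trans (cong ℕ→ℚ (sym (ℕP.m+[n∸m]≡n i≤j))) (ℕ→ℚ-+ i m)))
                      (solve 3 (λ z I M → z :+ (I :+ M) :- I := z :+ M) refl z (ℕ→ℚ i) (ℕ→ℚ m))

  numerator-vanishes : ∀ t → b < t → numerator t ≡ 0ℚ
  numerator-vanishes t b<t =
    trans (cong (λ x → ff x (2 ℕ.* t)) (sym (ℕ→ℚ-+ b t)))
          (ff-ℕ-vanishes (b ℕ.+ t) (2 ℕ.* t)
            (subst (b ℕ.+ t <_) (cong (t ℕ.+_) (sym (ℕP.+-identityʳ t))) (ℕP.+-monoˡ-< t b<t)))

  remainder-vanishes : ∀ t → b < t → remainder t ≡ 0ℚ
  remainder-vanishes t b<t =
    trans (cong (_⊘ remainder-denominator t) (numerator-vanishes t b<t))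
          (⊘-zeroˡ (remainder-denominator t))

  numerator-suc : ∀ t → numerator (suc t) ≡ (B + ℕ→ℚ t + 1ℚ) * numerator t * (B - ℕ→ℚ t)
  numerator-suc t = begin
    ff (B + ℕ→ℚ (suc t)) (2 ℕ.* suc t)
      ≡⟨ cong₂ ff (trans (cong (_+_ B) (ℕ→ℚ-suc t)) (sym (+-assoc B T 1ℚ))) (ℕP.*-suc 2 t) ⟩
    ff (B + T + 1ℚ) (suc (suc (2 ℕ.* t)))
      ≡⟨ ff-shift-suc (B + T) (2 ℕ.* t) ⟩
    (B + T + 1ℚ) * numerator t * (B + T - ℕ→ℚ (2 ℕ.* t))
      ≡⟨ cong (λ x → (B + T + 1ℚ) * numerator t * (B + T - x)) (ℕ→ℚ-double t) ⟩
    (B + T + 1ℚ) * numerator t * (B + T - (T + T))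
      ≡⟨ cong ((B + T + 1ℚ) * numerator t *_) (solve 2 (λ B T → B :+ T :- (T :+ T) := B :- T) refl B T) ⟩
    (B + T + 1ℚ) * numerator t * (B - T) ∎
    where
    open ≡-Reasoning
    T = ℕ→ℚ t

  denominator-factors : ∀ t → denominator t ≡ (z + ℕ→ℚ t) * inner t * (z - ℕ→ℚ (suc t))
  denominator-factors t = begin
    ff (z + T) (2 ℕ.* t ℕ.+ 2)
      ≡⟨ cong₂ ff (solve 2 (λ z T → z :+ T := z :+ T :- con 1ℚ :+ con 1ℚ) refl z T)
                  (ℕP.+-comm (2 ℕ.* t) 2) ⟩
    ff (z + T - 1ℚ + 1ℚ) (suc (suc (2 ℕ.* t)))
      ≡⟨ ff-shift-suc (z + T - 1ℚ) (2 ℕ.* t) ⟩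
    (z + T - 1ℚ + 1ℚ) * inner t * (z + T - 1ℚ - ℕ→ℚ (2 ℕ.* t))
      ≡⟨ cong₂ (λ x y → x * inner t * (z + T - 1ℚ - y))
               (solve 2 (λ z T → z :+ T :- con 1ℚ :+ con 1ℚ := z :+ T) refl z T) (ℕ→ℚ-double t) ⟩
    (z + T) * inner t * (z + T - 1ℚ - (T + T))
      ≡⟨ cong ((z + T) * inner t *_)
              (trans (solve 2 (λ z T → z :+ T :- con 1ℚ :- (T :+ T) := z :- (T :+ con 1ℚ)) refl z T)
                     (cong (_-_ z) (sym (ℕ→ℚ-suc t)))) ⟩
    (z + T) * inner t * (z - ℕ→ℚ (suc t)) ∎
    where
    open ≡-Reasoning
    T = ℕ→ℚ t

  inner-suc : ∀ t → inner (suc t) ≡ denominator t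
  inner-suc t = cong₂ ff z+[t+1]-1≡z+t (trans (ℕP.*-suc 2 t) (ℕP.+-comm 2 (2 ℕ.* t)))
    where
    z+[t+1]-1≡z+t : z + ℕ→ℚ (suc t) - ℕ→ℚ 1 ≡ z + ℕ→ℚ t
    z+[t+1]-1≡z+t = trans (cong (λ x → z + x - 1ℚ) (ℕ→ℚ-suc t))
                      (solve 2 (λ z T → z :+ (T :+ con 1ℚ) :- con 1ℚ := z :+ T) refl z (ℕ→ℚ t))

  remainder-denominator-suc : ∀ t →
    remainder-denominator (suc t) ≡ (z + B) * denominator t * (z - B - ℕ→ℚ 1)
  remainder-denominator-suc t = cong (λ x → (z + B) * x * (z - B - ℕ→ℚ 1)) (inner-suc t)

  module _ (t : ℕ) (t≤b : t ≤ b) where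
    private
      T = ℕ→ℚ t
      n = numerator t

    inner≢0 : inner t ≢ 0ℚ
    inner≢0 = ff-≢0 _ _ λ i i<2t → subst (_≢ 0ℚ) (z+t-[i+1]≡z+t-1-i i)
      (z+j-i≢0 t (suc i) (ℕP.m≤n⇒m≤o+n (suc i) t≤b)
                         (ℕP.≤-trans i<2t (ℕP.+-monoʳ-≤ t (ℕP.m≤n⇒m≤1+n t+0≤b))))
      where
      t+0≤b : t ℕ.+ 0 ≤ b
      t+0≤b = subst (_≤ b) (sym (ℕP.+-identityʳ t)) t≤b
      z+t-[i+1]≡z+t-1-i : ∀ i → z + T - ℕ→ℚ (suc i) ≡ z + T - ℕ→ℚ 1 - ℕ→ℚ i
      z+t-[i+1]≡z+t-1-i i = trans (cong (λ x → z + T - x) (ℕ→ℚ-suc i))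
        (solve 3 (λ z T I → z :+ T :- (I :+ con 1ℚ) := z :+ T :- con 1ℚ :- I) refl z T (ℕ→ℚ i))

    z+b≢0 : z + B ≢ 0ℚ
    z+b≢0 = z+m≢0 b ℕP.≤-refl

    z-b-1≢0 : z - B - ℕ→ℚ 1 ≢ 0ℚ
    z-b-1≢0 = subst (_≢ 0ℚ) z-[b+1]≡z-b-1 (z-m≢0 (suc b) ℕP.≤-refl)
      where
      z-[b+1]≡z-b-1 : z - ℕ→ℚ (suc b) ≡ z - B - ℕ→ℚ 1
      z-[b+1]≡z-b-1 = trans (cong (_-_ z) (ℕ→ℚ-suc b))
        (solve 2 (λ z B → z :- (B :+ con 1ℚ) := z :- B :- con 1ℚ) refl z B)

    denominator≢0 : denominator t ≢ 0ℚ
    denominator≢0 = subst (_≢ 0ℚ) (sym (denominator-factors t))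
      (*-≢0 (*-≢0 (z+m≢0 t t≤b) inner≢0) (z-m≢0 (suc t) (s≤s t≤b)))

    remainder-denominator≢0 : remainder-denominator t ≢ 0ℚ
    remainder-denominator≢0 = *-≢0 (*-≢0 z+b≢0 inner≢0) z-b-1≢0

    remainder-denominator-suc≢0 : remainder-denominator (suc t) ≢ 0ℚ
    remainder-denominator-suc≢0 = subst (_≢ 0ℚ) (sym (remainder-denominator-suc t))
      (*-≢0 (*-≢0 z+b≢0 denominator≢0) z-b-1≢0)

    term-telescopes-≤ : term t + remainder (suc t) ≡ remainder t
    term-telescopes-≤ = *-cancelʳ-≢0 _ _ D remainder-denominator-suc≢0
      (trans [term+remainder-suc]*D≡n*[z+t]*E (sym remainder*D≡n*[z+t]*E))
      where
      open ≡-Reasoning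
      D = remainder-denominator (suc t)
      E = z - ℕ→ℚ (suc t)

      [term+remainder-suc]*D≡n*[z+t]*E : (term t + remainder (suc t)) * D ≡ n * ((z + T) * E)
      [term+remainder-suc]*D≡n*[z+t]*E = begin
        (term t + remainder (suc t)) * D
          ≡⟨ *-distribʳ-+ D (term t) (remainder (suc t)) ⟩
        term t * D + remainder (suc t) * D
          ≡⟨ cong₂ _+_ (cong (term t *_) (remainder-denominator-suc t))
                       ([x⊘y]*y≡x _ _ remainder-denominator-suc≢0) ⟩
        term t * ((z + B) * denominator t * (z - B - 1ℚ)) + numerator (suc t)
          ≡⟨ cong₂ _+_ (solve 4 (λ q Q z B → q :* ((z :+ B) :* Q :* (z :- B :- con 1ℚ))
                                         := q :* Q :* ((z :+ B) :* (z :- B :- con 1ℚ)))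
                                refl (term t) (denominator t) z B)
                       (numerator-suc t) ⟩
        term t * denominator t * ((z + B) * (z - B - 1ℚ)) + (B + T + 1ℚ) * n * (B - T)
          ≡⟨ cong (λ x → x * ((z + B) * (z - B - 1ℚ)) + (B + T + 1ℚ) * n * (B - T))
                  ([x⊘y]*y≡x _ _ denominator≢0) ⟩
        n * ((z + B) * (z - B - 1ℚ)) + (B + T + 1ℚ) * n * (B - T)
          ≡⟨ solve 4 (λ n z B T → n :* ((z :+ B) :* (z :- B :- con 1ℚ)) :+ (B :+ T :+ con 1ℚ) :* n :* (B :- T)
                              := n :* ((z :+ B) :* (z :- B :- con 1ℚ) :+ (B :+ T :+ con 1ℚ) :* (B :- T)))
                     refl n z B T ⟩
        n * ((z + B) * (z - B - 1ℚ) + (B + T + 1ℚ) * (B - T))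
          ≡⟨ cong (n *_) (trans (quadratic-identity z B T) (cong (λ x → (z + T) * (z - x)) (sym (ℕ→ℚ-suc t)))) ⟩
        n * ((z + T) * E) ∎

      remainder*D≡n*[z+t]*E : remainder t * D ≡ n * ((z + T) * E)
      remainder*D≡n*[z+t]*E = begin
        remainder t * D
          ≡⟨ cong (remainder t *_) (remainder-denominator-suc t) ⟩
        remainder t * ((z + B) * denominator t * (z - B - 1ℚ))
          ≡⟨ cong (λ x → remainder t * ((z + B) * x * (z - B - 1ℚ))) (denominator-factors t) ⟩
        remainder t * ((z + B) * ((z + T) * inner t * E) * (z - B - 1ℚ))
          ≡⟨ solve 6 (λ r z B T P E → r :* ((z :+ B) :* ((z :+ T) :* P :* E) :* (z :- B :- con 1ℚ))
                                  := r :* ((z :+ B) :* P :* (z :- B :- con 1ℚ)) :* ((z :+ T) :* E))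
                     refl (remainder t) z B T (inner t) E ⟩
        remainder t * remainder-denominator t * ((z + T) * E)
          ≡⟨ cong (λ x → x * ((z + T) * E)) ([x⊘y]*y≡x _ _ remainder-denominator≢0) ⟩
        n * ((z + T) * E) ∎

  term-telescopes : ∀ t → term t + remainder (suc t) ≡ remainder t
  term-telescopes t with ℕP.≤-<-connex t b
  ... | inj₁ t≤b = term-telescopes-≤ t t≤b
  ... | inj₂ b<t
    rewrite numerator-vanishes t b<t | numerator-vanishes (suc t) (ℕP.m<n⇒m<1+n b<t)
          | ⊘-zeroˡ (denominator t) | ⊘-zeroˡ (remainder-denominator (suc t))
          | ⊘-zeroˡ (remainder-denominator t) = refl

  sum-closed-form : ∀ a N → N ≥ b → sumFromTo a N term ≡ remainder a
  sum-closed-form a N N≥b = sumFromTo-telescope term remainder term-telescopes a N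
    (λ t N<t → remainder-vanishes t (ℕP.≤-<-trans N≥b N<t))

lemma2 : (a b : ℕ) (z : ℚ)
    → (∀ (k : ℤ) → - (+ b) ≤ℤ k → k ≤ℤ + suc b → z ≢ k / 1)
    → (N : ℕ) → N ≥ b
    → sumFromTo a N (λ t → ff (ℕ→ℚ b + ℕ→ℚ t) (2 Data.Nat.* t) ⊘ ff (z + ℕ→ℚ t) (2 Data.Nat.* t Data.Nat.+ 2))
    ≡ ff (ℕ→ℚ b + ℕ→ℚ a) (2 Data.Nat.* a)
    ⊘ (((z + ℕ→ℚ b) * ff (z + ℕ→ℚ a - ℕ→ℚ 1) (2 Data.Nat.* a)) * (z - ℕ→ℚ b - ℕ→ℚ 1))
lemma2 a b z z∉[-b,b+1] N N≥b = ClosedForm.sum-closed-form b z z∉[-b,b+1] a N N≥b
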